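{- Let $d$ be a positive integer for which the word $\mathsf{ABB}$ is $d$-stackable. Then the words $\mathsf{ABCA}$, $\mathsf{ABBC}$, $\mathsf{ABBA}$, and $\mathsf{BABB}$ are $d$-stackable (here $\mathsf A,\mathsf B,\mathsf C$ are distinct letters).
   Context: A $d$-dimensional grid of shape $G=\prod_{i=1}^d\mathbb Z/n_i\mathbb Z$ is a map $\Gamma\colon G\to\Sigma$ to an alphabet; its size is $|G|$. For a word $w=w_0\cdots w_{\ell-1}$, an appearance of $w$ is a pair $(p,\mathbf v)\in G\times(\{ -1,0,1\}^d\setminus\{\mathbf 0\})$ with $\Gamma(p+i\mathbf v)=w_i$ for $0\le i<\ell$. The concentration $c_d(w,\Gamma)$ is the number of appearances divided by $|G|$; $C_d(w)$ is its supremum over all $d$-dimensional grids. A word $w$ is $d$-stackable if $C_d(w)=3^{d-1}C_1(w)$. -}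

module Defs where

open import Data.Nat using (ℕ; zero; suc; _+_; _*_; _∸_; _^_; _<_; _≡ᵇ_)
open import Data.Nat.DivMod using (_%_)
open import Data.Bool using (Bool; true; false; _∧_; _∨_; if_then_else_)
open import Data.Fin using (Fin; zero; suc)
open import Data.Vec using (Vec; []; _∷_)
open import Data.List using (List; []; _∷_; [_]; map; concatMap; upTo; filterᵇ; length)
open import Data.Product using (Σ; _×_)
open import Data.Nat.ListAction using (sum)

Word : Set
Word = List ℕ

A B C : ℕ
A = 0
B = 1
C = 2

-- A d-dimensional shape (n_1,…,n_d), stored as (m_1,…,m_d) with n_i = suc m_i
-- (so every n_i ≥ 1, as required for ℤ/n_iℤ).
Shape : ℕ → Set
Shape d = Vec ℕ d

size : ∀ {d} → Shape d → ℕ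
size []       = 1
size (m ∷ ms) = suc m * size ms

-- A point of G = ∏ ℤ/n_iℤ is represented by its canonical coordinates
-- (p_1,…,p_d) with 0 ≤ p_i < n_i.
Point : ℕ → Set
Point d = Vec ℕ d

allPoints : ∀ {d} → Shape d → List (Point d)
allPoints []       = [ [] ]
allPoints (m ∷ ms) = concatMap (λ x → map (x ∷_) (allPoints ms)) (upTo (suc m))

-- A grid over alphabet ℕ: only its values on canonical points matter.
Grid : ℕ → Set
Grid d = Point d → ℕ

-- Direction entries in {-1,0,1}: zero ↦ 0, suc zero ↦ +1, suc (suc zero) ↦ -1.
-- All vectors in {-1,0,1}^d.
allVec3 : (d : ℕ) → List (Vec (Fin 3) d)
allVec3 zero    = [ [] ]
allVec3 (suc d) = concatMap (λ x → map (x ∷_) (allVec3 d))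
                    (zero ∷ suc zero ∷ suc (suc zero) ∷ [])

isZeroDir : ∀ {d} → Vec (Fin 3) d → Bool
isZeroDir []           = true
isZeroDir (zero ∷ v)   = isZeroDir v
isZeroDir (suc _ ∷ _)  = false

notB : Bool → Bool
notB true  = false
notB false = true

directions : (d : ℕ) → List (Vec (Fin 3) d)
directions d = filterᵇ (λ v → notB (isZeroDir v)) (allVec3 d)

-- The offset of a direction entry modulo n = suc m  (-1 ≡ m mod suc m).
offset : ℕ → Fin 3 → ℕ
offset m zero             = 0
offset m (suc zero)       = 1
offset m (suc (suc zero)) = m

shift : ∀ {d} → Shape d → Point d → Vec (Fin 3) d → ℕ → Point d
shift []       []       []       i = []
shift (m ∷ ms) (p ∷ ps) (δ ∷ vs) i = ((p + i * offset m δ) % suc m) ∷ shift ms ps vs i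

matchFrom : ∀ {d} → Shape d → Grid d → Point d → Vec (Fin 3) d → ℕ → Word → Bool
matchFrom s Γ p v i []       = true
matchFrom s Γ p v i (c ∷ cs) = (Γ (shift s p v i) ≡ᵇ c) ∧ matchFrom s Γ p v (suc i) cs

boolToℕ : Bool → ℕ
boolToℕ true  = 1
boolToℕ false = 0

appearances : ∀ {d} → Shape d → Grid d → Word → ℕ
appearances {d} s Γ w =
  sum (map (λ p → sum (map (λ v → boolToℕ (matchFrom s Γ p v 0 w)) (directions d)))
           (allPoints s))

-- c_d(w,Γ) > a / (suc b), i.e.  appearances / |G| > a/(b+1).
ConcAbove : (d : ℕ) → Word → ℕ → ℕ → Set
ConcAbove d w a b = Σ (Shape d) λ s → Σ (Grid d) λ Γ → a * size s < appearances s Γ w * suc b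

-- 3^(d-1) c_1(w,Γ) > a/(suc b) for some 1-dimensional grid Γ.
ScaledConc1Above : (d : ℕ) → Word → ℕ → ℕ → Set
ScaledConc1Above d w a b =
  Σ (Shape 1) λ s → Σ (Grid 1) λ Γ → a * size s < 3 ^ (d ∸ 1) * appearances s Γ w * suc b

-- C_d(w) = 3^(d-1) C_1(w): the two suprema are equal, expressed as equality of
-- their (strict lower) Dedekind cuts over nonnegative rationals a/(b+1):
-- sup X > q  iff  sup Y > q  for every rational q ≥ 0.
Stackable : ℕ → Word → Set
Stackable d w = ∀ (a b : ℕ) →
  (ConcAbove d w a b → ScaledConc1Above d w a b) × (ScaledConc1Above d w a b → ConcAbove d w a b)

ABB ABCA ABBC ABBA BABB : Word
ABB  = A ∷ B ∷ B ∷ []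
ABCA = A ∷ B ∷ C ∷ A ∷ []
ABBC = A ∷ B ∷ B ∷ C ∷ []
ABBA = A ∷ B ∷ B ∷ A ∷ []
BABB = B ∷ A ∷ B ∷ B ∷ []

{-# OPTIONS --safe #-}
module Submission where

-- Every upper bound is reduced to one for ABB. An appearance of ABBA begins with an appearance of
-- ABB, and one of BABB ends with one. Recolouring C as B turns each appearance of ABCA, and each of
-- its reversal ACBA, into an appearance of ABBA; the two never share a position and direction, and
-- reversal does not change the count, so 2·C_d(ABCA) ≤ C_d(ABB). ABBC and CBBA behave the same way
-- when C is recoloured as A. Stackability of ABB and C_1(ABB) ≤ 2/3 bound C_d(w) by 3^(d-1)·2/3, or
-- by half of that, and cyclic words of length 3 or 6 attain the bound in dimension 1.
--
-- For C_1(ABB) ≤ 2/3, fix a direction v. The appearances along v and along -v number at most #A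
-- each, and at most #B together, because a B is the first B of at most one of them. Hence three
-- times their number is at most 2(#A + #B) ≤ 2|G|.
--
-- The reverse inequality C_d(w) ≥ 3^(d-1)·C_1(w) holds for every word. Adding a dimension of size 1
-- keeps |G|, and each direction becomes three directions that read the same letters.

open import Algebra.Properties.CommutativeSemigroup using (interchange)
open import Data.Bool using (Bool; true; false; T; _∧_; if_then_else_)
open import Data.Bool.Properties using (T-∧; ∧-comm; ∧-assoc; ∧-identityʳ)
open import Data.Empty using (⊥; ⊥-elim)
open import Data.Fin using (Fin; zero; suc; toℕ)
open import Data.List using (List; []; _∷_; [_]; _++_; _∷ʳ_; map; concatMap; filterᵇ; upTo; length; reverse; lookup; head; drop)
open import Data.List.Properties using (map-++; map-∘; map-cong; map-cong-local; upTo-∷ʳ; map-upTo; length-upTo; length-reverse; unfold-reverse)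
open import Data.List.Relation.Unary.All.Properties using (applyUpTo⁺₁)
open import Data.Maybe using (fromMaybe)
open import Data.Nat using (ℕ; zero; suc; _+_; _*_; _^_; _≤_; _<_; z≤n; s≤s; _≡ᵇ_; NonZero)
open import Data.Nat.DivMod using (_%_; %-distribˡ-+; m%n%n≡m%n; m<n⇒m%n≡m; n%n≡0; [m+kn]%n≡m%n)
open import Data.Nat.ListAction using (sum)
open import Data.Nat.ListAction.Properties using (sum-++)
open import Data.Nat.Properties
open import Data.Nat.Tactic.RingSolver using (solve-∀)
open import Data.Product using (Σ; _×_; _,_; proj₁; proj₂)
open import Data.Vec as Vec using (Vec; []; _∷_)
open import Function using (_∘_; Equivalence)
open import Relation.Binary.PropositionalEquality hiding ([_])

open import Defs

private variable
  X Y : Set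
  d : ℕ

∑ : List X → (X → ℕ) → ℕ
∑ xs f = sum (map f xs)

syntax ∑ xs (λ x → e) = ∑[ x ∈ xs ] e

module _ {f g : X → ℕ} where

  ∑-cong : ∀ xs → (∀ x → f x ≡ g x) → ∑ xs f ≡ ∑ xs g
  ∑-cong xs eq = cong sum (map-cong eq xs)

  ∑-mono : ∀ xs → (∀ x → f x ≤ g x) → ∑ xs f ≤ ∑ xs g
  ∑-mono []       le = z≤n
  ∑-mono (x ∷ xs) le = +-mono-≤ (le x) (∑-mono xs le)

  ∑-+ : ∀ xs → ∑[ x ∈ xs ] (f x + g x) ≡ ∑ xs f + ∑ xs g
  ∑-+ []       = refl
  ∑-+ (x ∷ xs) = trans (cong (f x + g x +_) (∑-+ xs))
                       (interchange +-commutativeSemigroup (f x) (g x) _ _)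

∑-*ˡ : ∀ c (f : X → ℕ) xs → ∑[ x ∈ xs ] (c * f x) ≡ c * ∑ xs f
∑-*ˡ c f []       = sym (*-zeroʳ c)
∑-*ˡ c f (x ∷ xs) = trans (cong (c * f x +_) (∑-*ˡ c f xs)) (sym (*-distribˡ-+ c (f x) _))

∑-const : ∀ c (xs : List X) → ∑[ x ∈ xs ] c ≡ length xs * c
∑-const c []       = refl
∑-const c (x ∷ xs) = cong (c +_) (∑-const c xs)

∑-++ : ∀ (f : X → ℕ) xs ys → ∑ (xs ++ ys) f ≡ ∑ xs f + ∑ ys f
∑-++ f xs ys = trans (cong sum (map-++ f xs ys)) (sum-++ (map f xs) (map f ys))

∑-map : ∀ (f : Y → ℕ) (g : X → Y) xs → ∑ (map g xs) f ≡ ∑ xs (f ∘ g)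
∑-map f g xs = cong sum (sym (map-∘ xs))

∑-concatMap : ∀ (f : Y → ℕ) (g : X → List Y) xs → ∑ (concatMap g xs) f ≡ ∑[ x ∈ xs ] ∑ (g x) f
∑-concatMap f g []       = refl
∑-concatMap f g (x ∷ xs) =
  trans (∑-++ f (g x) (concatMap g xs)) (cong (∑ (g x) f +_) (∑-concatMap f g xs))

∑-comm : ∀ (f : X → Y → ℕ) xs ys → ∑[ x ∈ xs ] ∑[ y ∈ ys ] f x y ≡ ∑[ y ∈ ys ] ∑[ x ∈ xs ] f x y
∑-comm f []       ys = sym (trans (∑-const 0 ys) (*-zeroʳ (length ys)))
∑-comm f (x ∷ xs) ys = trans (cong (∑ ys (f x) +_) (∑-comm f xs ys)) (sym (∑-+ ys))

∑-filterᵇ : ∀ (P : X → Bool) (f : X → ℕ) xs → ∑ (filterᵇ P xs) f ≡ ∑[ x ∈ xs ] (if P x then f x else 0)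
∑-filterᵇ P f []       = refl
∑-filterᵇ P f (x ∷ xs) with P x
... | true  = cong (f x +_) (∑-filterᵇ P f xs)
... | false = ∑-filterᵇ P f xs

∑-upTo-cong : ∀ n {f g : ℕ → ℕ} → (∀ {x} → x < n → f x ≡ g x) → ∑ (upTo n) f ≡ ∑ (upTo n) g
∑-upTo-cong n eq = cong sum (map-cong-local (applyUpTo⁺₁ (λ x → x) n eq))

[m%n+k]%n≡[m+k]%n : ∀ m k n .{{_ : NonZero n}} → (m % n + k) % n ≡ (m + k) % n
[m%n+k]%n≡[m+k]%n m k n = begin
  (m % n + k) % n         ≡⟨ %-distribˡ-+ (m % n) k n ⟩
  (m % n % n + k % n) % n ≡⟨ cong (λ r → (r + k % n) % n) (m%n%n≡m%n m n) ⟩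
  (m % n + k % n) % n     ≡⟨ %-distribˡ-+ m k n ⟨
  (m + k) % n             ∎
  where open ≡-Reasoning

∑-upTo-rotate₁ : ∀ m (K : ℕ → ℕ) → ∑[ x ∈ upTo (suc m) ] K ((x + 1) % suc m) ≡ ∑ (upTo (suc m)) K
∑-upTo-rotate₁ m K = begin
  ∑[ x ∈ upTo (suc m) ] K ((x + 1) % suc m)
    ≡⟨ cong (λ xs → ∑[ x ∈ xs ] K ((x + 1) % suc m)) (upTo-∷ʳ m) ⟨
  ∑[ x ∈ upTo m ∷ʳ m ] K ((x + 1) % suc m)
    ≡⟨ ∑-++ _ (upTo m) [ m ] ⟩
  ∑[ x ∈ upTo m ] K ((x + 1) % suc m) + (K ((m + 1) % suc m) + 0)
    ≡⟨ cong₂ _+_ (∑-upTo-cong m (cong K ∘ next)) (cong (λ r → K r + 0) wrap) ⟩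
  ∑ (upTo m) (K ∘ suc) + (K 0 + 0)
    ≡⟨ trans (cong (∑ (upTo m) (K ∘ suc) +_) (+-identityʳ (K 0))) (+-comm _ (K 0)) ⟩
  K 0 + ∑ (upTo m) (K ∘ suc)
    ≡⟨ cong (K 0 +_) (trans (cong (λ xs → ∑ xs K) (sym (map-upTo suc m))) (∑-map K suc (upTo m))) ⟨
  ∑ (upTo (suc m)) K ∎
  where
  open ≡-Reasoning
  next : ∀ {x} → x < m → (x + 1) % suc m ≡ suc x
  next {x} x<m = trans (cong (_% suc m) (+-comm x 1)) (m<n⇒m%n≡m (s≤s x<m))
  wrap : (m + 1) % suc m ≡ 0
  wrap = trans (cong (_% suc m) (+-comm m 1)) (n%n≡0 (suc m))

∑-upTo-rotate : ∀ m c (K : ℕ → ℕ) → ∑[ x ∈ upTo (suc m) ] K ((x + c) % suc m) ≡ ∑ (upTo (suc m)) K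
∑-upTo-rotate m zero    K = ∑-upTo-cong (suc m) (cong K ∘ fixed)
  where
  fixed : ∀ {x} → x < suc m → (x + 0) % suc m ≡ x
  fixed {x} x<n = trans (cong (_% suc m) (+-identityʳ x)) (m<n⇒m%n≡m x<n)
∑-upTo-rotate m (suc c) K = begin
  ∑[ x ∈ upTo (suc m) ] K ((x + suc c) % suc m)           ≡⟨ ∑-cong (upTo (suc m)) (cong K ∘ step) ⟩
  ∑[ x ∈ upTo (suc m) ] K (((x + c) % suc m + 1) % suc m) ≡⟨ ∑-upTo-rotate m c (λ y → K ((y + 1) % suc m)) ⟩
  ∑[ y ∈ upTo (suc m) ] K ((y + 1) % suc m)               ≡⟨ ∑-upTo-rotate₁ m K ⟩
  ∑ (upTo (suc m)) K                                      ∎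
  where
  open ≡-Reasoning
  step : ∀ x → (x + suc c) % suc m ≡ ((x + c) % suc m + 1) % suc m
  step x = trans (cong (_% suc m) (trans (+-suc x c) (+-comm 1 (x + c))))
                 (sym ([m%n+k]%n≡[m+k]%n (x + c) 1 (suc m)))

-- Lines in the torus

oppositeEntry : Fin 3 → Fin 3
oppositeEntry zero             = zero
oppositeEntry (suc zero)       = suc (suc zero)
oppositeEntry (suc (suc zero)) = suc zero

opposite : Vec (Fin 3) d → Vec (Fin 3) d
opposite = Vec.map oppositeEntry

shift-shift : ∀ (s : Shape d) p v a i → shift s (shift s p v a) v i ≡ shift s p v (a + i)
shift-shift []       []       []       a i = refl
shift-shift (m ∷ ms) (x ∷ ps) (δ ∷ vs) a i = cong₂ _∷_
  (trans ([m%n+k]%n≡[m+k]%n (x + a * o) (i * o) (suc m)) (cong (_% suc m) (collect x a i o)))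
  (shift-shift ms ps vs a i)
  where
  o = offset m δ
  collect : ∀ x a i o → x + a * o + i * o ≡ x + (a + i) * o
  collect = solve-∀

-- The offsets of δ and of its opposite add up to 0 or to the modulus suc m.
shift-opposite : ∀ (s : Shape d) p v a j → shift s (shift s p v (a + j)) (opposite v) j ≡ shift s p v a
shift-opposite []       []       []       a j = refl
shift-opposite (m ∷ ms) (x ∷ ps) (δ ∷ vs) a j = cong₂ _∷_
  (trans ([m%n+k]%n≡[m+k]%n (x + (a + j) * o) (j * o′) (suc m))
    (trans (cong (_% suc m) (regroup x a j o o′)) (cancel δ)))
  (shift-opposite ms ps vs a j)
  where
  o  = offset m δ
  o′ = offset m (oppositeEntry δ)
  regroup : ∀ x a j o o′ → x + (a + j) * o + j * o′ ≡ x + a * o + j * (o + o′)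
  regroup = solve-∀
  cancel : ∀ δ → (x + a * offset m δ + j * (offset m δ + offset m (oppositeEntry δ))) % suc m
               ≡ (x + a * offset m δ) % suc m
  cancel zero             = cong (_% suc m) (trans (cong (x + a * 0 +_) (*-zeroʳ j)) (+-identityʳ _))
  cancel (suc zero)       = [m+kn]%n≡m%n (x + a * 1) j (suc m)
  cancel (suc (suc zero)) = trans (cong (λ n → (x + a * m + j * n) % suc m) (+-comm m 1))
                                  ([m+kn]%n≡m%n (x + a * m) j (suc m))

∑-allPoints-shift : ∀ (s : Shape d) v i (h : Point d → ℕ) →
  ∑[ p ∈ allPoints s ] h (shift s p v i) ≡ ∑ (allPoints s) h
∑-allPoints-shift []       []       i h = refl
∑-allPoints-shift (m ∷ ms) (δ ∷ vs) i h = begin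
  ∑[ p ∈ concatMap slice (upTo (suc m)) ] h (shift (m ∷ ms) p (δ ∷ vs) i)
    ≡⟨ ∑-concatMap _ slice (upTo (suc m)) ⟩
  ∑[ x ∈ upTo (suc m) ] ∑[ p ∈ slice x ] h (shift (m ∷ ms) p (δ ∷ vs) i)
    ≡⟨ ∑-cong (upTo (suc m)) (λ x → trans (∑-map _ (x ∷_) (allPoints ms))
         (∑-allPoints-shift ms vs i (λ q → h (((x + i * offset m δ) % suc m) ∷ q)))) ⟩
  ∑[ x ∈ upTo (suc m) ] layer ((x + i * offset m δ) % suc m)
    ≡⟨ ∑-upTo-rotate m (i * offset m δ) layer ⟩
  ∑ (upTo (suc m)) layer
    ≡⟨ ∑-cong (upTo (suc m)) (λ x → ∑-map h (x ∷_) (allPoints ms)) ⟨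
  ∑[ x ∈ upTo (suc m) ] ∑ (slice x) h
    ≡⟨ ∑-concatMap h slice (upTo (suc m)) ⟨
  ∑ (concatMap slice (upTo (suc m))) h ∎
  where
  open ≡-Reasoning
  slice : ℕ → List (Point _)
  slice x = map (x ∷_) (allPoints ms)
  layer : ℕ → ℕ
  layer y = ∑[ q ∈ allPoints ms ] h (y ∷ q)

∑-allPoints-1 : ∀ (s : Shape d) → ∑[ p ∈ allPoints s ] 1 ≡ size s
∑-allPoints-1 []       = refl
∑-allPoints-1 (m ∷ ms) = begin
  ∑[ p ∈ concatMap slice (upTo (suc m)) ] 1 ≡⟨ ∑-concatMap (λ _ → 1) slice (upTo (suc m)) ⟩
  ∑[ x ∈ upTo (suc m) ] ∑[ p ∈ slice x ] 1  ≡⟨ ∑-cong (upTo (suc m)) sliceSize ⟩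
  ∑[ x ∈ upTo (suc m) ] size ms             ≡⟨ ∑-const (size ms) (upTo (suc m)) ⟩
  length (upTo (suc m)) * size ms           ≡⟨ cong (_* size ms) (length-upTo (suc m)) ⟩
  suc m * size ms                           ∎
  where
  open ≡-Reasoning
  slice : ℕ → List (Point _)
  slice x = map (x ∷_) (allPoints ms)
  sliceSize : ∀ x → ∑[ p ∈ slice x ] 1 ≡ size ms
  sliceSize x = trans (∑-map (λ _ → 1) (x ∷_) (allPoints ms)) (∑-allPoints-1 ms)

size-nonZero : ∀ (s : Shape d) → NonZero (size s)
size-nonZero []       = _
size-nonZero (m ∷ ms) = m*n≢0 (suc m) (size ms) {{_}} {{size-nonZero ms}}

isZeroDir-opposite : ∀ (v : Vec (Fin 3) d) → isZeroDir (opposite v) ≡ isZeroDir v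
isZeroDir-opposite []                   = refl
isZeroDir-opposite (zero ∷ v)           = isZeroDir-opposite v
isZeroDir-opposite (suc zero ∷ v)       = refl
isZeroDir-opposite (suc (suc zero) ∷ v) = refl

module _ where

  private
    nonzero : Vec (Fin 3) d → Bool
    nonzero v = notB (isZeroDir v)

    entries : List (Fin 3)
    entries = zero ∷ suc zero ∷ suc (suc zero) ∷ []

    layer : ∀ d → Fin 3 → List (Vec (Fin 3) (suc d))
    layer d δ = map (δ ∷_) (allVec3 d)

  ∑-allVec3-opposite : ∀ d (f : Vec (Fin 3) d → ℕ) → ∑[ v ∈ allVec3 d ] f (opposite v) ≡ ∑ (allVec3 d) f
  ∑-allVec3-opposite zero    f = refl
  ∑-allVec3-opposite (suc d) f = begin
    ∑[ v ∈ allVec3 (suc d) ] f (opposite v)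
      ≡⟨ ∑-concatMap _ (layer d) entries ⟩
    ∑[ δ ∈ entries ] ∑[ v ∈ layer d δ ] f (opposite v)
      ≡⟨ ∑-cong entries (λ δ → trans (∑-map (f ∘ opposite) (δ ∷_) (allVec3 d))
           (∑-allVec3-opposite d (λ u → f (oppositeEntry δ ∷ u)))) ⟩
    F zero + (F (suc (suc zero)) + (F (suc zero) + 0))
      ≡⟨ cong (F zero +_) (swap (F (suc (suc zero))) (F (suc zero))) ⟩
    ∑[ δ ∈ entries ] F δ
      ≡⟨ ∑-cong entries (λ δ → ∑-map f (δ ∷_) (allVec3 d)) ⟨
    ∑[ δ ∈ entries ] ∑ (layer d δ) f
      ≡⟨ ∑-concatMap f (layer d) entries ⟨
    ∑ (allVec3 (suc d)) f ∎
    where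
    open ≡-Reasoning
    F : Fin 3 → ℕ
    F δ = ∑[ u ∈ allVec3 d ] f (δ ∷ u)
    swap : ∀ a b → a + (b + 0) ≡ b + (a + 0)
    swap = solve-∀

  ∑-directions-opposite : ∀ d (f : Vec (Fin 3) d → ℕ) →
    ∑[ v ∈ directions d ] f (opposite v) ≡ ∑ (directions d) f
  ∑-directions-opposite d f = begin
    ∑[ v ∈ directions d ] f (opposite v)
      ≡⟨ ∑-filterᵇ nonzero _ (allVec3 d) ⟩
    ∑[ v ∈ allVec3 d ] (if nonzero v then f (opposite v) else 0)
      ≡⟨ ∑-cong (allVec3 d) (λ v → cong (λ z → if notB z then f (opposite v) else 0) (isZeroDir-opposite v)) ⟨
    ∑[ v ∈ allVec3 d ] (if nonzero (opposite v) then f (opposite v) else 0)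
      ≡⟨ ∑-allVec3-opposite d (λ v → if nonzero v then f v else 0) ⟩
    ∑[ v ∈ allVec3 d ] (if nonzero v then f v else 0)
      ≡⟨ ∑-filterᵇ nonzero f (allVec3 d) ⟨
    ∑ (directions d) f ∎
    where open ≡-Reasoning

  ∑-directions-extend : ∀ d (g : Vec (Fin 3) d → ℕ) →
    3 * ∑ (directions d) g ≤ ∑[ v ∈ directions (suc d) ] g (Vec.tail v)
  ∑-directions-extend d g = begin
    3 * ∑ (directions d) g
      ≡⟨ cong (3 *_) (∑-filterᵇ nonzero g (allVec3 d)) ⟩
    ∑[ δ ∈ entries ] ∑[ u ∈ allVec3 d ] (if nonzero u then g u else 0)
      ≤⟨ ∑-mono entries (λ δ → ∑-mono (allVec3 d) (extend δ)) ⟩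
    ∑[ δ ∈ entries ] ∑[ u ∈ allVec3 d ] (if nonzero (δ ∷ u) then g u else 0)
      ≡⟨ ∑-cong entries (λ δ → ∑-map G (δ ∷_) (allVec3 d)) ⟨
    ∑[ δ ∈ entries ] ∑ (layer d δ) G
      ≡⟨ ∑-concatMap G (layer d) entries ⟨
    ∑ (allVec3 (suc d)) G
      ≡⟨ ∑-filterᵇ nonzero (g ∘ Vec.tail) (allVec3 (suc d)) ⟨
    ∑[ v ∈ directions (suc d) ] g (Vec.tail v) ∎
    where
    open ≤-Reasoning
    G : Vec (Fin 3) (suc d) → ℕ
    G v = if nonzero v then g (Vec.tail v) else 0
    extend : ∀ δ u → (if nonzero u then g u else 0) ≤ (if nonzero (δ ∷ u) then g u else 0)
    extend zero    u = ≤-refl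
    extend (suc δ) u with nonzero u
    ... | true  = ≤-refl
    ... | false = z≤n

∑PD : Shape d → (Point d → Vec (Fin 3) d → ℕ) → ℕ
∑PD {d} s H = ∑[ p ∈ allPoints s ] ∑[ v ∈ directions d ] H p v

module _ (s : Shape d) where

  ∑PD-mono : {H H′ : Point d → Vec (Fin 3) d → ℕ} → (∀ p v → H p v ≤ H′ p v) → ∑PD s H ≤ ∑PD s H′
  ∑PD-mono le = ∑-mono (allPoints s) (λ p → ∑-mono (directions d) (le p))

  ∑PD-cong : {H H′ : Point d → Vec (Fin 3) d → ℕ} → (∀ p v → H p v ≡ H′ p v) → ∑PD s H ≡ ∑PD s H′
  ∑PD-cong eq = ∑-cong (allPoints s) (λ p → ∑-cong (directions d) (eq p))

  ∑PD-+ : (H H′ : Point d → Vec (Fin 3) d → ℕ) → ∑PD s (λ p v → H p v + H′ p v) ≡ ∑PD s H + ∑PD s H′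
  ∑PD-+ H H′ = trans (∑-cong (allPoints s) (λ p → ∑-+ (directions d))) (∑-+ (allPoints s))

  ∑PD-shift : ∀ a (H : Point d → Vec (Fin 3) d → ℕ) → ∑PD s (λ p v → H (shift s p v a) v) ≡ ∑PD s H
  ∑PD-shift a H = begin
    ∑PD s (λ p v → H (shift s p v a) v)
      ≡⟨ ∑-comm (λ p v → H (shift s p v a) v) (allPoints s) (directions d) ⟩
    ∑[ v ∈ directions d ] ∑[ p ∈ allPoints s ] H (shift s p v a) v
      ≡⟨ ∑-cong (directions d) (λ v → ∑-allPoints-shift s v a (λ q → H q v)) ⟩
    ∑[ v ∈ directions d ] ∑[ p ∈ allPoints s ] H p v
      ≡⟨ ∑-comm H (allPoints s) (directions d) ⟨
    ∑PD s H ∎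
    where open ≡-Reasoning

  ∑PD-opposite : (H : Point d → Vec (Fin 3) d → ℕ) → ∑PD s (λ p v → H p (opposite v)) ≡ ∑PD s H
  ∑PD-opposite H = ∑-cong (allPoints s) (λ p → ∑-directions-opposite d (H p))

boolToℕ-mono : ∀ {a b} → (T a → T b) → boolToℕ a ≤ boolToℕ b
boolToℕ-mono {false}         _   = z≤n
boolToℕ-mono {true}  {true}  _   = ≤-refl
boolToℕ-mono {true}  {false} a⇒b = ⊥-elim (a⇒b _)

boolToℕ-+-≤ : ∀ {a b c} → (T a → T c) → (T b → T c) → (T a → T b → ⊥) →
  boolToℕ a + boolToℕ b ≤ boolToℕ c
boolToℕ-+-≤ {false}         _   b⇒c _        = boolToℕ-mono b⇒c
boolToℕ-+-≤ {true}  {false} a⇒c _   _        = ≤-trans (≤-reflexive (+-identityʳ 1)) (boolToℕ-mono a⇒c)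
boolToℕ-+-≤ {true}  {true}  _   _   disjoint = ⊥-elim (disjoint _ _)

appears : Shape d → Grid d → Word → Point d → Vec (Fin 3) d → ℕ
appears s Γ w p v = boolToℕ (matchFrom s Γ p v 0 w)

module _ (s : Shape d) (Γ : Grid d) where

  match-∷⁻ : ∀ {p v i} c w → T (matchFrom s Γ p v i (c ∷ w)) →
    Γ (shift s p v i) ≡ c × T (matchFrom s Γ p v (suc i) w)
  match-∷⁻ {p} {v} {i} c w m with Equivalence.to T-∧ m
  ... | first , rest = ≡ᵇ⇒≡ (Γ (shift s p v i)) c first , rest

  match-shift : ∀ p v a i w → matchFrom s Γ (shift s p v a) v i w ≡ matchFrom s Γ p v (a + i) w
  match-shift p v a i []      = refl
  match-shift p v a i (c ∷ w) = cong₂ _∧_ (cong (λ q → Γ q ≡ᵇ c) (shift-shift s p v a i))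
    (trans (match-shift p v a (suc i) w) (cong (λ j → matchFrom s Γ p v j w) (+-suc a i)))

  match-++ : ∀ p v i u w →
    matchFrom s Γ p v i (u ++ w) ≡ matchFrom s Γ p v i u ∧ matchFrom s Γ p v (i + length u) w
  match-++ p v i []      w = cong (λ j → matchFrom s Γ p v j w) (sym (+-identityʳ i))
  match-++ p v i (c ∷ u) w = trans (cong ((Γ (shift s p v i) ≡ᵇ c) ∧_) (trans (match-++ p v (suc i) u w) later))
                                   (sym (∧-assoc (Γ (shift s p v i) ≡ᵇ c) _ _))
    where
    later : matchFrom s Γ p v (suc i) u ∧ matchFrom s Γ p v (suc i + length u) w
          ≡ matchFrom s Γ p v (suc i) u ∧ matchFrom s Γ p v (i + suc (length u)) w
    later = cong (λ j → matchFrom s Γ p v (suc i) u ∧ matchFrom s Γ p v j w) (sym (+-suc i (length u)))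

  match-++⁻ˡ : ∀ {p v i} u w → T (matchFrom s Γ p v i (u ++ w)) → T (matchFrom s Γ p v i u)
  match-++⁻ˡ {p} {v} {i} u w m = proj₁ (Equivalence.to T-∧ (subst T (match-++ p v i u w) m))

  -- Reading along -v from p + (a + j + |w|)v, starting at index suc j, visits the cells
  -- p + (a + |w| - 1)v, …, p + av in which w is read forwards from index a.
  match-reverse : ∀ p v a j w →
    matchFrom s Γ (shift s p v (a + (j + length w))) (opposite v) (suc j) (reverse w) ≡ matchFrom s Γ p v a w
  match-reverse p v a j []      = refl
  match-reverse p v a j (c ∷ w) = begin
    matchFrom s Γ R (opposite v) (suc j) (reverse (c ∷ w))
      ≡⟨ cong (matchFrom s Γ R (opposite v) (suc j)) (unfold-reverse c w) ⟩
    matchFrom s Γ R (opposite v) (suc j) (reverse w ++ [ c ])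
      ≡⟨ match-++ R (opposite v) (suc j) (reverse w) [ c ] ⟩
    matchFrom s Γ R (opposite v) (suc j) (reverse w)
      ∧ ((Γ (shift s R (opposite v) (suc j + length (reverse w))) ≡ᵇ c) ∧ true)
      ≡⟨ cong₂ (λ x q → x ∧ ((Γ q ≡ᵇ c) ∧ true)) later first ⟩
    matchFrom s Γ p v (suc a) w ∧ ((Γ (shift s p v a) ≡ᵇ c) ∧ true)
      ≡⟨ trans (cong (matchFrom s Γ p v (suc a) w ∧_) (∧-identityʳ _)) (∧-comm (matchFrom s Γ p v (suc a) w) _) ⟩
    (Γ (shift s p v a) ≡ᵇ c) ∧ matchFrom s Γ p v (suc a) w ∎
    where
    open ≡-Reasoning
    ℓ = length w
    R = shift s p v (a + (j + suc ℓ))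
    R≡ : a + (j + suc ℓ) ≡ a + suc (j + ℓ)
    R≡ = cong (a +_) (+-suc j ℓ)
    later : matchFrom s Γ R (opposite v) (suc j) (reverse w) ≡ matchFrom s Γ p v (suc a) w
    later = trans (cong (λ n → matchFrom s Γ (shift s p v n) (opposite v) (suc j) (reverse w))
                        (trans R≡ (+-suc a (j + ℓ))))
                  (match-reverse p v (suc a) j w)
    first : shift s R (opposite v) (suc j + length (reverse w)) ≡ shift s p v a
    first = trans (cong₂ (λ n k → shift s (shift s p v n) (opposite v) k) R≡ (cong (suc j +_) (length-reverse w)))
                  (shift-opposite s p v a (suc (j + ℓ)))

  match-lookup : ∀ {p v i} w → T (matchFrom s Γ p v i w) → (k : Fin (length w)) →
    Γ (shift s p v (i + toℕ k)) ≡ lookup w k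
  match-lookup {p} {v} {i} (c ∷ w) m zero    =
    trans (cong (λ j → Γ (shift s p v j)) (+-identityʳ i)) (proj₁ (match-∷⁻ c w m))
  match-lookup {p} {v} {i} (c ∷ w) m (suc k) =
    trans (cong (λ j → Γ (shift s p v j)) (+-suc i (toℕ k))) (match-lookup w (proj₂ (match-∷⁻ c w m)) k)

  match-unique : ∀ {p v i} w w′ → length w ≡ length w′ →
    T (matchFrom s Γ p v i w) → T (matchFrom s Γ p v i w′) → w ≡ w′
  match-unique []      []        _  _ _  = refl
  match-unique (c ∷ w) (c′ ∷ w′) eq m m′ with match-∷⁻ c w m | match-∷⁻ c′ w′ m′
  ... | c≡ , rest | c′≡ , rest′ =
    cong₂ _∷_ (trans (sym c≡) c′≡) (match-unique w w′ (suc-injective eq) rest rest′)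

  match-map : ∀ (f : ℕ → ℕ) {p v i} w → T (matchFrom s Γ p v i w) → T (matchFrom s (f ∘ Γ) p v i (map f w))
  match-map f []      m = m
  match-map f (c ∷ w) m with match-∷⁻ c w m
  ... | c≡ , rest = Equivalence.from T-∧ (≡⇒≡ᵇ _ _ (cong f c≡) , match-map f w rest)

  match-pad : ∀ p v i w → matchFrom (0 ∷ s) (Γ ∘ Vec.tail) (0 ∷ p) v i w ≡ matchFrom s Γ p (Vec.tail v) i w
  match-pad p (δ ∷ u) i []      = refl
  match-pad p (δ ∷ u) i (c ∷ w) = cong (_ ∧_) (match-pad p (δ ∷ u) (suc i) w)

  appearances-++ˡ : ∀ u w → appearances s Γ (u ++ w) ≤ appearances s Γ u
  appearances-++ˡ u w = ∑PD-mono s (λ p v → boolToℕ-mono (match-++⁻ˡ u w))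

  appearances-∷ : ∀ c w → appearances s Γ (c ∷ w) ≤ appearances s Γ w
  appearances-∷ c w = begin
    appearances s Γ (c ∷ w)
      ≤⟨ ∑PD-mono s (λ p v → boolToℕ-mono (subst T (sym (match-shift p v 1 0 w)) ∘ proj₂ ∘ match-∷⁻ c w)) ⟩
    ∑PD s (λ p v → appears s Γ w (shift s p v 1) v)
      ≡⟨ ∑PD-shift s 1 (appears s Γ w) ⟩
    appearances s Γ w ∎
    where open ≤-Reasoning

  appearances-reverse : ∀ w → appearances s Γ (reverse w) ≡ appearances s Γ w
  appearances-reverse w = sym (begin
    appearances s Γ w
      ≡⟨ ∑PD-cong s (λ p v → cong boolToℕ (trans (sym (match-reverse p v 0 0 w))
                                                 (sym (match-shift _ (opposite v) 1 0 (reverse w))))) ⟩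
    ∑PD s (λ p v → H (shift s p v (length w)) v)
      ≡⟨ ∑PD-shift s (length w) H ⟩
    ∑PD s H
      ≡⟨ ∑PD-opposite s (λ q u → appears s Γ (reverse w) (shift s q u 1) u) ⟩
    ∑PD s (λ q u → appears s Γ (reverse w) (shift s q u 1) u)
      ≡⟨ ∑PD-shift s 1 (appears s Γ (reverse w)) ⟩
    appearances s Γ (reverse w) ∎)
    where
    open ≡-Reasoning
    H : Point d → Vec (Fin 3) d → ℕ
    H q v = appears s Γ (reverse w) (shift s q (opposite v) 1) (opposite v)

  appearances-disjoint : ∀ (Γ′ : Grid d) w₁ w₂ u →
    (∀ {p v} → T (matchFrom s Γ p v 0 w₁) → T (matchFrom s Γ′ p v 0 u)) →
    (∀ {p v} → T (matchFrom s Γ p v 0 w₂) → T (matchFrom s Γ′ p v 0 u)) →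
    (∀ {p v} → T (matchFrom s Γ p v 0 w₁) → T (matchFrom s Γ p v 0 w₂) → ⊥) →
    appearances s Γ w₁ + appearances s Γ w₂ ≤ appearances s Γ′ u
  appearances-disjoint Γ′ w₁ w₂ u w₁⇒u w₂⇒u disjoint = begin
    appearances s Γ w₁ + appearances s Γ w₂
      ≡⟨ ∑PD-+ s (appears s Γ w₁) (appears s Γ w₂) ⟨
    ∑PD s (λ p v → appears s Γ w₁ p v + appears s Γ w₂ p v)
      ≤⟨ ∑PD-mono s (λ p v → boolToℕ-+-≤ w₁⇒u w₂⇒u disjoint) ⟩
    appearances s Γ′ u ∎
    where open ≤-Reasoning

appearances-recolour-reverse : ∀ (s : Shape d) Γ (f : ℕ → ℕ) w u {x y} → w ≢ reverse w →
  map f w ≡ u ++ x → map f (reverse w) ≡ u ++ y → 2 * appearances s Γ w ≤ appearances s (f ∘ Γ) u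
appearances-recolour-reverse s Γ f w u w≢w⁻¹ fw fw⁻¹ = begin
  2 * appearances s Γ w
    ≡⟨ cong (appearances s Γ w +_) (trans (+-identityʳ _) (sym (appearances-reverse s Γ w))) ⟩
  appearances s Γ w + appearances s Γ (reverse w)
    ≤⟨ appearances-disjoint s Γ (f ∘ Γ) w (reverse w) u (recoloured w fw) (recoloured (reverse w) fw⁻¹) disjoint ⟩
  appearances s (f ∘ Γ) u ∎
  where
  open ≤-Reasoning
  recoloured : ∀ w′ {x p v} → map f w′ ≡ u ++ x → T (matchFrom s Γ p v 0 w′) → T (matchFrom s (f ∘ Γ) p v 0 u)
  recoloured w′ {x} {p} {v} eq =
    match-++⁻ˡ s (f ∘ Γ) u x ∘ subst (T ∘ matchFrom s (f ∘ Γ) p v 0) eq ∘ match-map s Γ f w′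
  disjoint : ∀ {p v} → T (matchFrom s Γ p v 0 w) → T (matchFrom s Γ p v 0 (reverse w)) → ⊥
  disjoint m m⁻¹ = w≢w⁻¹ (match-unique s Γ w (reverse w) (sym (length-reverse w)) m m⁻¹)

appearances-pad : ∀ (s : Shape d) Γ w → 3 * appearances s Γ w ≤ appearances (0 ∷ s) (Γ ∘ Vec.tail) w
appearances-pad {d} s Γ w = begin
  3 * appearances s Γ w
    ≡⟨ ∑-*ˡ 3 _ (allPoints s) ⟨
  ∑[ p ∈ allPoints s ] (3 * ∑[ u ∈ directions d ] appears s Γ w p u)
    ≤⟨ ∑-mono (allPoints s) (λ p → ∑-directions-extend d (appears s Γ w p)) ⟩
  ∑[ p ∈ allPoints s ] ∑[ v ∈ directions (suc d) ] appears s Γ w p (Vec.tail v)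
    ≡⟨ ∑-cong (allPoints s) (λ p → ∑-cong (directions (suc d)) (λ v → cong boolToℕ (match-pad s Γ p v 0 w))) ⟨
  ∑[ p ∈ allPoints s ] F (0 ∷ p)
    ≡⟨ trans (∑-concatMap F (λ x → map (x ∷_) (allPoints s)) (upTo 1))
             (trans (+-identityʳ _) (∑-map F (0 ∷_) (allPoints s))) ⟨
  appearances (0 ∷ s) (Γ ∘ Vec.tail) w ∎
  where
  open ≤-Reasoning
  F : Point (suc d) → ℕ
  F p = ∑[ v ∈ directions (suc d) ] appears (0 ∷ s) (Γ ∘ Vec.tail) w p v

-- Stacking a one-dimensional grid

stackShape : ∀ k → Shape 1 → Shape (suc k)
stackShape zero    s = s
stackShape (suc k) s = 0 ∷ stackShape k s

stackGrid : ∀ k → Grid 1 → Grid (suc k)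
stackGrid zero    γ = γ
stackGrid (suc k) γ = stackGrid k γ ∘ Vec.tail

size-stack : ∀ k s → size (stackShape k s) ≡ size s
size-stack zero    s = refl
size-stack (suc k) s = trans (+-identityʳ _) (size-stack k s)

appearances-stack : ∀ k s γ w → 3 ^ k * appearances s γ w ≤ appearances (stackShape k s) (stackGrid k γ) w
appearances-stack zero    s γ w = ≤-reflexive (*-identityˡ _)
appearances-stack (suc k) s γ w = begin
  3 * 3 ^ k * appearances s γ w                              ≡⟨ *-assoc 3 (3 ^ k) _ ⟩
  3 * (3 ^ k * appearances s γ w)                            ≤⟨ *-monoʳ-≤ 3 (appearances-stack k s γ w) ⟩
  3 * appearances (stackShape k s) (stackGrid k γ) w         ≤⟨ appearances-pad (stackShape k s) (stackGrid k γ) w ⟩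
  appearances (stackShape (suc k) s) (stackGrid (suc k) γ) w ∎
  where open ≤-Reasoning

ScaledConc1Above⇒ConcAbove : ∀ k w a b → ScaledConc1Above (suc k) w a b → ConcAbove (suc k) w a b
ScaledConc1Above⇒ConcAbove k w a b (s , γ , above) = stackShape k s , stackGrid k γ , (begin-strict
  a * size (stackShape k s)                              ≡⟨ cong (a *_) (size-stack k s) ⟩
  a * size s                                             <⟨ above ⟩
  3 ^ k * appearances s γ w * suc b                      ≤⟨ *-monoˡ-≤ (suc b) (appearances-stack k s γ w) ⟩
  appearances (stackShape k s) (stackGrid k γ) w * suc b ∎)
  where open ≤-Reasoning

-- The one-dimensional bound for ABB

appearancesAlong : Shape d → Grid d → Word → Vec (Fin 3) d → ℕ
appearancesAlong s Γ w v = ∑[ p ∈ allPoints s ] appears s Γ w p v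

≡ᵇA+≡ᵇB≤1 : ∀ x → boolToℕ (x ≡ᵇ A) + boolToℕ (x ≡ᵇ B) ≤ 1
≡ᵇA+≡ᵇB≤1 0             = ≤-refl
≡ᵇA+≡ᵇB≤1 1             = ≤-refl
≡ᵇA+≡ᵇB≤1 (suc (suc x)) = z≤n

module _ (s : Shape d) (Γ : Grid d) (v : Vec (Fin 3) d) where

  private
    isA isB : Point d → ℕ
    isA p = boolToℕ (Γ p ≡ᵇ A)
    isB p = boolToℕ (Γ p ≡ᵇ B)

    countABB : Vec (Fin 3) d → ℕ
    countABB = appearancesAlong s Γ ABB

    letter : ∀ {p u} (k : Fin 3) → T (matchFrom s Γ p u 0 ABB) → Γ (shift s p u (toℕ k)) ≡ lookup ABB k
    letter k m = match-lookup s Γ ABB m k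

  countABB≤∑isA : ∀ u → countABB u ≤ ∑ (allPoints s) isA
  countABB≤∑isA u = begin
    countABB u
      ≤⟨ ∑-mono (allPoints s) (λ p → boolToℕ-mono (≡⇒≡ᵇ _ _ ∘ letter zero)) ⟩
    ∑[ p ∈ allPoints s ] isA (shift s p u 0)
      ≡⟨ ∑-allPoints-shift s u 0 isA ⟩
    ∑ (allPoints s) isA ∎
    where open ≤-Reasoning

  -- Both words have their first B at p + v, but they need B and A respectively at p + 2v.
  ABB-overlap : ∀ p → appears s Γ ABB p v + appears s Γ ABB (shift s p v 2) (opposite v) ≤ isB (shift s p v 1)
  ABB-overlap p = boolToℕ-+-≤
    (λ m → ≡⇒≡ᵇ _ _ (letter (suc zero) m))
    (λ m → ≡⇒≡ᵇ _ _ (trans (cong Γ (sym (shift-opposite s p v 1 1))) (letter (suc zero) m)))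
    (λ m m′ → B≢A (trans (sym (letter (suc (suc zero)) m))
                         (trans (cong Γ (sym (shift-opposite s p v 2 0))) (letter zero m′))))
    where
    B≢A : B ≢ A
    B≢A ()

  countABB-antipodal≤∑isB : countABB v + countABB (opposite v) ≤ ∑ (allPoints s) isB
  countABB-antipodal≤∑isB = begin
    countABB v + countABB (opposite v)
      ≡⟨ cong (countABB v +_) (∑-allPoints-shift s v 2 (λ q → appears s Γ ABB q (opposite v))) ⟨
    countABB v + ∑[ p ∈ allPoints s ] appears s Γ ABB (shift s p v 2) (opposite v)
      ≡⟨ ∑-+ (allPoints s) ⟨
    ∑[ p ∈ allPoints s ] (appears s Γ ABB p v + appears s Γ ABB (shift s p v 2) (opposite v))
      ≤⟨ ∑-mono (allPoints s) ABB-overlap ⟩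
    ∑[ p ∈ allPoints s ] isB (shift s p v 1)
      ≡⟨ ∑-allPoints-shift s v 1 isB ⟩
    ∑ (allPoints s) isB ∎
    where open ≤-Reasoning

  appearancesAlong-ABB-antipodal :
    3 * (appearancesAlong s Γ ABB v + appearancesAlong s Γ ABB (opposite v)) ≤ 2 * size s
  appearancesAlong-ABB-antipodal = begin
    3 * N
      ≤⟨ +-mono-≤ N≤2∑isA (*-monoʳ-≤ 2 countABB-antipodal≤∑isB) ⟩
    2 * ∑ (allPoints s) isA + 2 * ∑ (allPoints s) isB
      ≡⟨ *-distribˡ-+ 2 (∑ (allPoints s) isA) _ ⟨
    2 * (∑ (allPoints s) isA + ∑ (allPoints s) isB)
      ≡⟨ cong (2 *_) (∑-+ (allPoints s)) ⟨
    2 * ∑[ p ∈ allPoints s ] (isA p + isB p)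
      ≤⟨ *-monoʳ-≤ 2 (∑-mono (allPoints s) (≡ᵇA+≡ᵇB≤1 ∘ Γ)) ⟩
    2 * ∑[ p ∈ allPoints s ] 1
      ≡⟨ cong (2 *_) (∑-allPoints-1 s) ⟩
    2 * size s ∎
    where
    open ≤-Reasoning
    N = countABB v + countABB (opposite v)
    N≤2∑isA : N ≤ 2 * ∑ (allPoints s) isA
    N≤2∑isA = +-mono-≤ (countABB≤∑isA v) (≤-trans (countABB≤∑isA (opposite v)) (m≤m+n _ 0))

appearances-ABB-1D : ∀ (s : Shape 1) γ → 3 * appearances s γ ABB ≤ 2 * size s
appearances-ABB-1D s γ = begin
  3 * appearances s γ ABB
    ≡⟨ cong (3 *_) (trans (∑-cong (allPoints s) (λ p → cong (appears s γ ABB p forward +_) (+-identityʳ _)))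
                          (∑-+ (allPoints s))) ⟩
  3 * (appearancesAlong s γ ABB forward + appearancesAlong s γ ABB (opposite forward))
    ≤⟨ appearancesAlong-ABB-antipodal s γ forward ⟩
  2 * size s ∎
  where
  open ≤-Reasoning
  forward : Vec (Fin 3) 1
  forward = suc zero ∷ []

ScaledConc1Above-ABB-bound : ∀ k a b → ScaledConc1Above (suc k) ABB a b → a * 3 < 3 ^ k * 2 * suc b
ScaledConc1Above-ABB-bound k a b (s , γ , above) = *-cancelʳ-< (size s) (a * 3) (3 ^ k * 2 * suc b) (begin-strict
  a * 3 * size s                            ≡⟨ reorder₁ a (size s) ⟩
  a * size s * 3                            <⟨ *-monoˡ-< 3 above ⟩
  3 ^ k * appearances s γ ABB * suc b * 3   ≡⟨ reorder₂ (3 ^ k) (appearances s γ ABB) (suc b) ⟩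
  3 ^ k * suc b * (3 * appearances s γ ABB) ≤⟨ *-monoʳ-≤ (3 ^ k * suc b) (appearances-ABB-1D s γ) ⟩
  3 ^ k * suc b * (2 * size s)              ≡⟨ reorder₃ (3 ^ k) (suc b) (size s) ⟩
  3 ^ k * 2 * suc b * size s                ∎)
  where
  open ≤-Reasoning
  reorder₁ : ∀ a n → a * 3 * n ≡ a * n * 3
  reorder₁ = solve-∀
  reorder₂ : ∀ t x b → t * x * b * 3 ≡ t * b * (3 * x)
  reorder₂ = solve-∀
  reorder₃ : ∀ t b n → t * b * (2 * n) ≡ t * 2 * b * n
  reorder₃ = solve-∀

dense⇒ScaledConc1Above : ∀ k c w a b (s : Shape 1) γ → 2 * size s ≤ 3 * c * appearances s γ w →
  c * a * 3 < 3 ^ k * 2 * suc b → ScaledConc1Above (suc k) w a b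
dense⇒ScaledConc1Above k c w a b s γ dense below = s , γ , *-cancelʳ-< (3 * c) (a * size s) _ (begin-strict
  a * size s * (3 * c)         ≡⟨ reorder₁ a (size s) c ⟩
  c * a * 3 * size s           <⟨ *-monoˡ-< (size s) {{size-nonZero s}} below ⟩
  3 ^ k * 2 * suc b * size s   ≡⟨ reorder₂ (3 ^ k) (suc b) (size s) ⟩
  3 ^ k * suc b * (2 * size s) ≤⟨ *-monoʳ-≤ (3 ^ k * suc b) dense ⟩
  3 ^ k * suc b * (3 * c * n)  ≡⟨ reorder₃ (3 ^ k) (suc b) c n ⟩
  3 ^ k * n * suc b * (3 * c)  ∎)
  where
  open ≤-Reasoning
  n = appearances s γ w
  reorder₁ : ∀ a n c → a * n * (3 * c) ≡ c * a * 3 * n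
  reorder₁ = solve-∀
  reorder₂ : ∀ t b n → t * 2 * b * n ≡ t * b * (2 * n)
  reorder₂ = solve-∀
  reorder₃ : ∀ t b c x → t * b * (3 * c * x) ≡ t * x * b * (3 * c)
  reorder₃ = solve-∀

Dominated : ℕ → ℕ → Word → Word → Set
Dominated d c w u = (s : Shape d) (Γ : Grid d) → Σ (Grid d) λ Γ′ → c * appearances s Γ w ≤ appearances s Γ′ u

ConcAbove-dominated : ∀ {c w u a b} .{{_ : NonZero c}} → Dominated d c w u →
  ConcAbove d w a b → ConcAbove d u (c * a) b
ConcAbove-dominated {c = c} {w} {u} {a} {b} dominated (s , Γ , above) with dominated s Γ
... | Γ′ , le = s , Γ′ , (begin-strict
  c * a * size s                  ≡⟨ *-assoc c a (size s) ⟩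
  c * (a * size s)                <⟨ *-monoʳ-< c above ⟩
  c * (appearances s Γ w * suc b) ≡⟨ *-assoc c (appearances s Γ w) (suc b) ⟨
  c * appearances s Γ w * suc b   ≤⟨ *-monoˡ-≤ (suc b) le ⟩
  appearances s Γ′ u * suc b      ∎)
  where open ≤-Reasoning

stackable-via-ABB : ∀ k c .{{_ : NonZero c}} w → Stackable (suc k) ABB → Dominated (suc k) c w ABB →
  (s : Shape 1) (γ : Grid 1) → 2 * size s ≤ 3 * c * appearances s γ w → Stackable (suc k) w
stackable-via-ABB k c w stackable-ABB dominated s γ dense a b = upper , ScaledConc1Above⇒ConcAbove k w a b
  where
  upper : ConcAbove (suc k) w a b → ScaledConc1Above (suc k) w a b
  upper = dense⇒ScaledConc1Above k c w a b s γ dense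
        ∘ ScaledConc1Above-ABB-bound k (c * a) b
        ∘ proj₁ (stackable-ABB (c * a) b)
        ∘ ConcAbove-dominated {w = w} {u = ABB} dominated

recolour : ℕ → ℕ → ℕ → ℕ
recolour x y c = if c ≡ᵇ x then y else c

dominated-ABCA : Dominated d 2 ABCA ABB
dominated-ABCA s Γ = recolour C B ∘ Γ , appearances-recolour-reverse s Γ (recolour C B) ABCA ABB (λ ()) refl refl

dominated-ABBC : Dominated d 2 ABBC ABB
dominated-ABBC s Γ = recolour C A ∘ Γ , appearances-recolour-reverse s Γ (recolour C A) ABBC ABB (λ ()) refl refl

dominated-ABBA : Dominated d 1 ABBA ABB
dominated-ABBA s Γ = Γ , ≤-trans (≤-reflexive (*-identityˡ _)) (appearances-++ˡ s Γ ABB [ A ])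

dominated-BABB : Dominated d 1 BABB ABB
dominated-BABB s Γ = Γ , ≤-trans (≤-reflexive (*-identityˡ _)) (appearances-∷ s Γ B ABB)

-- The default letter is never read at the points of a shape with length w cells.
wordGrid : Word → Grid 1
wordGrid w (x ∷ []) = fromMaybe A (head (drop x w))

lemma4p3 : (d : ℕ) → 1 ≤ d → Stackable d ABB →
    Stackable d ABCA × Stackable d ABBC × Stackable d ABBA × Stackable d BABB
lemma4p3 (suc k) _ stackable-ABB =
    stackable-via-ABB k 2 ABCA stackable-ABB dominated-ABCA (5 ∷ []) (wordGrid (ABC ++ ABC)) ≤-refl
  , stackable-via-ABB k 2 ABBC stackable-ABB dominated-ABBC (5 ∷ []) (wordGrid (ABBC ++ B ∷ B ∷ [])) ≤-refl
  , stackable-via-ABB k 1 ABBA stackable-ABB dominated-ABBA (2 ∷ []) (wordGrid ABB) ≤-refl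
  , stackable-via-ABB k 1 BABB stackable-ABB dominated-BABB (2 ∷ []) (wordGrid ABB) ≤-refl
  where
  ABC : Word
  ABC = A ∷ B ∷ C ∷ []
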